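{- Let $(B,\sqsubseteq)$ be a bounded complete predomain base on which consistency is continuous, and let $I\subseteq\hat B$ be finite and consistent. Then (1) for every $n\in\mathbb N$ the set $I_n=\{x_n\mid (x_n)_n\in I\}\subseteq B$ is consistent, and (2) $\bigsqcup I=(\bigsqcup I_n)_n$ in $\hat B$. In particular $\hat B$ is bounded complete and finite suprema of consistent sets are computed pointwise.
   Context: Work constructively; $\tilde\exists x.A$ abbreviates $\neg\forall x.\neg A$. In a poset, a chain is a sequence $(x_n)$ with $x_n\sqsubseteq x_{n+1}$; $b\ll c$ means: for every chain $(x_n)$ whose supremum exists and satisfies $c\sqsubseteq\bigsqcup_n x_n$, there weakly exists $n$ with $b\sqsubseteq x_n$. An approximating sequence of $b$ is a chain $(b_n)$ with $b_n\ll b$ and $\bigsqcup_n b_n=b$. A predomain base is a countable poset with decidable order in which every element has an approximating sequence. A nonempty finite subset is consistent if it weakly has an upper bound; bounded complete means every finite consistent subset has a least upper bound. Consistency is continuous if for every nonempty finite $J$ and $a_i=\bigsqcup_j a_{i,j}$ ($i\in J$, chains $(a_{i,j})_j$) with $\{a_{i,j}\mid i\in J\}$ consistent for every $j$, the set $\{a_i\mid i\in J\}$ is consistent. The continuous completion $\hat B$ is the set of increasing sequences in $B$, preordered by $(b_n)\sqsubseteq(b'_n)$ iff for all $b\in B$, $n$, $b\ll b_n$ implies $\tilde\exists m.\,b\ll b'_m$; equality is mutual $\sqsubseteq$, and consistency/suprema in $\hat B$ refer to this order. -}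

module Defs where

open import Data.Nat using (ℕ; suc)
open import Data.Fin using (Fin)
open import Data.Product using (Σ; _×_; ∃)
open import Relation.Nullary using (¬_; Dec)
open import Relation.Binary.PropositionalEquality using (_≡_)

∃̃ : {A : Set} → (A → Set) → Set
∃̃ {A} P = ¬ ((x : A) → ¬ P x)

record CountableDecPoset : Set₁ where
  field
    Carrier    : Set
    _⊑_        : Carrier → Carrier → Set
    ⊑-refl     : ∀ {x} → x ⊑ x
    ⊑-trans    : ∀ {x y z} → x ⊑ y → y ⊑ z → x ⊑ z
    ⊑-antisym  : ∀ {x y} → x ⊑ y → y ⊑ x → x ≡ y
    _⊑?_       : ∀ x y → Dec (x ⊑ y)
    enum       : ℕ → Carrier
    enum-surj  : ∀ b → ∃ λ n → enum n ≡ b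

module PosetNotions (P : CountableDecPoset) where
  open CountableDecPoset P

  IsChain : (ℕ → Carrier) → Set
  IsChain x = ∀ n → x n ⊑ x (suc n)

  IsSup : (ℕ → Carrier) → Carrier → Set
  IsSup x s = (∀ n → x n ⊑ s) × (∀ u → (∀ n → x n ⊑ u) → s ⊑ u)

  _≪_ : Carrier → Carrier → Set
  b ≪ c = ∀ (x : ℕ → Carrier) → IsChain x → ∀ s → IsSup x s → c ⊑ s →
          ∃̃ λ n → b ⊑ x n

  IsApproxSeq : (ℕ → Carrier) → Carrier → Set
  IsApproxSeq x b = IsChain x × (∀ n → x n ≪ b) × IsSup x b

  -- nonempty finite subsets are given as families Fin (suc k) → Carrier
  IsUB : ∀ {k} → (Fin (suc k) → Carrier) → Carrier → Set
  IsUB a u = ∀ i → a i ⊑ u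

  IsLub : ∀ {k} → (Fin (suc k) → Carrier) → Carrier → Set
  IsLub a u = IsUB a u × (∀ v → IsUB a v → u ⊑ v)

  Consistent : ∀ {k} → (Fin (suc k) → Carrier) → Set
  Consistent a = ∃̃ λ u → IsUB a u

  BoundedComplete : Set
  BoundedComplete = ∀ k (a : Fin (suc k) → Carrier) → Consistent a → Σ Carrier (IsLub a)

  ConsistencyContinuous : Set
  ConsistencyContinuous =
    ∀ k (a : Fin (suc k) → ℕ → Carrier) (s : Fin (suc k) → Carrier) →
    (∀ i → IsChain (a i)) → (∀ i → IsSup (a i) (s i)) →
    (∀ j → Consistent (λ i → a i j)) → Consistent s

record PredomainBase : Set₁ where
  field
    poset : CountableDecPoset
  open CountableDecPoset poset public
  open PosetNotions poset public
  field
    approx    : Carrier → ℕ → Carrier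
    approx-ok : ∀ b → IsApproxSeq (approx b) b

module Completion (B : PredomainBase) where
  open PredomainBase B

  record B̂ : Set where
    constructor mkB̂
    field
      seq   : ℕ → Carrier
      chain : IsChain seq
  open B̂ public

  _⊑̂_ : B̂ → B̂ → Set
  x ⊑̂ y = ∀ (b : Carrier) (n : ℕ) → b ≪ seq x n → ∃̃ λ m → b ≪ seq y m

  IsUB̂ : ∀ {k} → (Fin (suc k) → B̂) → B̂ → Set
  IsUB̂ I u = ∀ i → I i ⊑̂ u

  IsLub̂ : ∀ {k} → (Fin (suc k) → B̂) → B̂ → Set
  IsLub̂ I u = IsUB̂ I u × (∀ v → IsUB̂ I v → u ⊑̂ v)

  Consistent̂ : ∀ {k} → (Fin (suc k) → B̂) → Set
  Consistent̂ I = ∃̃ λ u → IsUB̂ I u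

-- Let I be a finite family in B̂ with a (weak) upper bound v.  Approximants
-- a i ≪ seq (I i) n are each way below some stage of v.  Finitely many
-- "eventually true" upward-closed properties hold simultaneously at a common
-- stage (`weakly-eventually-all`), so all a i lie below a single seq v m.
-- Hence approximants of the n-th stages are consistent (`consistent-below`),
-- and continuity of consistency lifts this to the stages themselves (part 1).
-- For part 2, c n = ⊔ᵢ seq (I i) n is the supremum of the chain of finite lubs
-- of the approximants (`lubs-commute-sups`, `approximant-lubs`); an element way
-- below c n is thus below one such lub, and the lub of finitely many elements
-- way below seq v m is itself way below it (`lub-≪`).
module Submission where

open import Defs
open import Data.Nat using (ℕ; suc; zero; _≤_; _≤′_; ≤′-refl; ≤′-step; _⊔_)
open import Data.Nat.Properties using (≤⇒≤′; m≤m⊔n; m≤n⊔m)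
open import Data.Fin using (Fin; zero; suc)
open import Data.Product using (Σ; _×_; _,_; proj₁; proj₂)
open import Data.Empty using (⊥-elim)
open import Relation.Nullary using (yes; no)

∃̃-intro : {A : Set} {P : A → Set} (x : A) → P x → ∃̃ P
∃̃-intro x px ¬P = ¬P x px

∃̃-bind : {A A′ : Set} {P : A → Set} {Q : A′ → Set} →
  ∃̃ P → (∀ x → P x → ∃̃ Q) → ∃̃ Q
∃̃-bind p f ¬Q = p (λ x px → f x px ¬Q)

Upward : (ℕ → Set) → Set
Upward P = ∀ {m m′} → m ≤ m′ → P m → P m′

weakly-eventually-all : ∀ n (P : Fin n → ℕ → Set) → (∀ i → Upward (P i)) →
  (∀ i → ∃̃ (P i)) → ∃̃ (λ m → ∀ i → P i m)
weakly-eventually-all zero P up h = ∃̃-intro 0 (λ ())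
weakly-eventually-all (suc n) P up h =
  ∃̃-bind (h zero) λ m₀ p₀ →
  ∃̃-bind (weakly-eventually-all n (λ i → P (suc i)) (λ i → up (suc i)) (λ i → h (suc i))) λ m₁ ps →
  ∃̃-intro (m₀ ⊔ m₁) λ { zero    → up zero (m≤m⊔n m₀ m₁) p₀
                      ; (suc i) → up (suc i) (m≤n⊔m m₀ m₁) (ps i) }

module PosetFacts (P : CountableDecPoset) where
  open CountableDecPoset P
  open PosetNotions P

  chain-mono : ∀ {x} → IsChain x → ∀ {m m′} → m ≤ m′ → x m ⊑ x m′
  chain-mono {x} ch p = go (≤⇒≤′ p)
    where
      go : ∀ {m m′} → m ≤′ m′ → x m ⊑ x m′
      go ≤′-refl      = ⊑-refl
      go (≤′-step q) = ⊑-trans (go q) (ch _)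

  -- Way-below implies below: test against the constant chain at c.  The
  -- resulting ¬¬(b ⊑ c) is turned into b ⊑ c by decidability of the order.
  ≪⇒⊑ : ∀ {b c} → b ≪ c → b ⊑ c
  ≪⇒⊑ {b} {c} b≪c with b ⊑? c
  ... | yes b⊑c = b⊑c
  ... | no  b⋢c = ⊥-elim (b≪c (λ _ → c) (λ _ → ⊑-refl) c constant-sup ⊑-refl (λ _ → b⋢c))
    where
      constant-sup : IsSup (λ _ → c) c
      constant-sup = (λ _ → ⊑-refl) , (λ u h → h 0)

  ≪-⊑ : ∀ {b c d} → b ≪ c → c ⊑ d → b ≪ d
  ≪-⊑ b≪c c⊑d x ch s sup d⊑s = b≪c x ch s sup (⊑-trans c⊑d d⊑s)

  ⊑-≪ : ∀ {b c d} → b ⊑ c → c ≪ d → b ≪ d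
  ⊑-≪ b⊑c c≪d x ch s sup d⊑s = ∃̃-bind (c≪d x ch s sup d⊑s) λ n c⊑xn → ∃̃-intro n (⊑-trans b⊑c c⊑xn)

  ≪-chain-upward : ∀ {b} {x : ℕ → Carrier} → IsChain x → Upward (λ m → b ≪ x m)
  ≪-chain-upward ch m≤m′ b≪xm = ≪-⊑ b≪xm (chain-mono ch m≤m′)

  -- The lub of finitely many elements way below w is way below w: each lies
  -- below the chain from some stage on, hence all of them at a common stage.
  lub-≪ : ∀ {k w} (a : Fin (suc k) → Carrier) d → IsLub a d → (∀ i → a i ≪ w) → d ≪ w
  lub-≪ {k} a d (_ , least) a≪w x ch s sup w⊑s =
    ∃̃-bind (weakly-eventually-all (suc k) (λ i n → a i ⊑ x n)
               (λ i m≤m′ ai⊑xm → ⊑-trans ai⊑xm (chain-mono ch m≤m′))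
               (λ i → a≪w i x ch s sup w⊑s))
      λ N a⊑xN → ∃̃-intro N (least (x N) a⊑xN)

  module _ {k} (a : Fin (suc k) → ℕ → Carrier) (d : ℕ → Carrier)
           (d-lub : ∀ j → IsLub (λ i → a i j) (d j)) where

    lubs-chain : (∀ i → IsChain (a i)) → IsChain d
    lubs-chain ch j = proj₂ (d-lub j) (d (suc j))
      (λ i → ⊑-trans (ch i j) (proj₁ (d-lub (suc j)) i))

    lubs-commute-sups : ∀ (x : Fin (suc k) → Carrier) c →
      (∀ i → IsSup (a i) (x i)) → IsLub x c → IsSup d c
    lubs-commute-sups x c x-sup (c-ub , c-least) =
      (λ j → proj₂ (d-lub j) c (λ i → ⊑-trans (proj₁ (x-sup i) j) (c-ub i)))
      , (λ w d⊑w → c-least w (λ i →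
           proj₂ (x-sup i) w (λ j → ⊑-trans (proj₁ (d-lub j) i) (d⊑w j))))

module CompletionFacts (B : PredomainBase) where
  open PredomainBase B
  open Completion B
  open PosetFacts poset

  approx-chain : ∀ b → IsChain (approx b)
  approx-chain b = proj₁ (approx-ok b)

  approx-≪ : ∀ b j → approx b j ≪ b
  approx-≪ b = proj₁ (proj₂ (approx-ok b))

  approx-sup : ∀ b → IsSup (approx b) b
  approx-sup b = proj₂ (proj₂ (approx-ok b))

  module _ {k} (I : Fin (suc k) → B̂) where

    common-stage : ∀ v → IsUB̂ I v → ∀ n (a : Fin (suc k) → Carrier) →
      (∀ i → a i ≪ seq (I i) n) → ∃̃ λ m → ∀ i → a i ≪ seq v m
    common-stage v v-ub n a a≪I =
      weakly-eventually-all (suc k) (λ i m → a i ≪ seq v m)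
        (λ i → ≪-chain-upward (chain v)) (λ i → v-ub i (a i) n (a≪I i))

    consistent-below : Consistent̂ I → ∀ n (a : Fin (suc k) → Carrier) →
      (∀ i → a i ≪ seq (I i) n) → Consistent a
    consistent-below cons n a a≪I =
      ∃̃-bind cons λ v v-ub →
      ∃̃-bind (common-stage v v-ub n a a≪I) λ m a≪v →
      ∃̃-intro (seq v m) (λ i → ≪⇒⊑ (a≪v i))

  approximant-lubs : BoundedComplete → ∀ {k} (x : Fin (suc k) → Carrier) c → IsLub x c →
    Σ (ℕ → Carrier) λ d → (∀ j → IsLub (λ i → approx (x i) j) (d j)) × IsChain d × IsSup d c
  approximant-lubs bc {k} x c c-lub = d , d-lub , lubs-chain a d d-lub (λ i → approx-chain (x i))
                                    , lubs-commute-sups a d d-lub x c (λ i → approx-sup (x i)) c-lub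
    where
      a : Fin (suc k) → ℕ → Carrier
      a i = approx (x i)
      bounded-by-c : ∀ j → Consistent (λ i → a i j)
      bounded-by-c j = ∃̃-intro c (λ i → ⊑-trans (≪⇒⊑ (approx-≪ (x i) j)) (proj₁ c-lub i))
      d : ℕ → Carrier
      d j = proj₁ (bc k (λ i → a i j) (bounded-by-c j))
      d-lub : ∀ j → IsLub (λ i → a i j) (d j)
      d-lub j = proj₂ (bc k (λ i → a i j) (bounded-by-c j))

  stages-consistent : ConsistencyContinuous → ∀ k (I : Fin (suc k) → B̂) → Consistent̂ I →
    (n : ℕ) → Consistent (λ i → seq (I i) n)
  stages-consistent cc k I cons n =
    cc k (λ i → approx (seq (I i) n)) (λ i → seq (I i) n)
       (λ i → approx-chain _) (λ i → approx-sup _)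
       (λ j → consistent-below I cons n _ (λ i → approx-≪ _ j))

  pointwise-lub : BoundedComplete → ∀ {k} (I : Fin (suc k) → B̂) (c : ℕ → Carrier) →
    ((n : ℕ) → IsLub (λ i → seq (I i) n) (c n)) → Σ (IsChain c) (λ ch → IsLub̂ I (mkB̂ c ch))
  pointwise-lub bc I c c-lub = c-chain , c-ub , c-least
    where
      c-chain : IsChain c
      c-chain = lubs-chain (λ i → seq (I i)) c c-lub (λ i → chain (I i))

      c-ub : IsUB̂ I (mkB̂ c c-chain)
      c-ub i b n b≪I = ∃̃-intro n (≪-⊑ b≪I (proj₁ (c-lub n) i))

      -- b ≪ c n lies below some lub d j of approximants, and d j is way
      -- below a stage of v since its finitely many constituents are.
      c-least : ∀ v → IsUB̂ I v → mkB̂ c c-chain ⊑̂ v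
      c-least v v-ub b n b≪c
        with approximant-lubs bc (λ i → seq (I i) n) (c n) (c-lub n)
      ... | d , d-lub , d-chain , d-sup =
        ∃̃-bind (b≪c d d-chain (c n) d-sup ⊑-refl) λ j b⊑d →
        ∃̃-bind (common-stage I v v-ub n _ (λ i → approx-≪ _ j)) λ m a≪v →
        ∃̃-intro m (⊑-≪ b⊑d (lub-≪ _ (d j) (d-lub j) a≪v))

lemma3p7 : (B : PredomainBase) →
    let open PredomainBase B in
    let open Completion B in
    BoundedComplete → ConsistencyContinuous →
    (k : ℕ) (I : Fin (suc k) → B̂) → Consistent̂ I →
    ((n : ℕ) → Consistent (λ i → seq (I i) n))
    × ((c : ℕ → Carrier) → ((n : ℕ) → IsLub (λ i → seq (I i) n) (c n)) →
    Σ (IsChain c) (λ ch → IsLub̂ I (mkB̂ c ch)))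
lemma3p7 B bc cc k I cons = stages-consistent cc k I cons , pointwise-lub bc I
  where open CompletionFacts B
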